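{- Let $s\in\{6,18,30,42\}$ (so that $\gcd(96,s)=6$). Then each of the following pairs of circulant graphs is a pair of Type-2 isomorphic circulant graphs with respect to $m=2$: (u) $C_{96}(1,s,47)$ and $C_{96}(s,23,25)$; (v) $C_{96}(3,s,45)$ and $C_{96}(s,21,27)$; (w) $C_{96}(5,s,43)$ and $C_{96}(s,19,29)$; (x) $C_{96}(7,s,41)$ and $C_{96}(s,17,31)$; (y) $C_{96}(9,s,39)$ and $C_{96}(s,15,33)$; (z) $C_{96}(11,s,37)$ and $C_{96}(s,13,35)$.
   Context: For an integer $n\ge 2$ and a set $R\subseteq\{1,\dots,\lfloor n/2\rfloor\}$, the circulant graph $C_n(R)$ has vertex set $\{v_0,\dots,v_{n-1}\}$ (indices modulo $n$), and $v_iv_j$ is an edge iff $i-j\equiv \pm r \pmod n$ for some $r\in R$; we write $C_n(a,b,c)$ for $C_n(\{a,b,c\})$, etc. The reflexive modular reduction of a collection of integers reduces each modulo $n$ to $r'\in\{0,\dots,n-1\}$ and then replaces $r'$ by $n-r'$ whenever $r'>n/2$. For $x$ with $\gcd(n,x)=1$, $xR$ denotes the reflexive modular reduction of $\{xr: r\in R\}$. Given $m>1$ and $0\le t\le n/m-1$, the map $\theta_{n,m,t}$ sends the vertex $v_x$ ($x\in\mathbb{Z}_n$, written $x=qm+j$ with $0\le j\le m-1$) to $u_{x+jtm}$ (subscripts modulo $n$, where $u_0,\dots,u_{n-1}$ are the vertices of $K_n$) and an edge $(v_x,v_{x+s})$ to $(\theta_{n,m,t}(v_x),\theta_{n,m,t}(v_{x+s}))$.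 Two circulant graphs $C_n(R)$ and $C_n(S)$ are called Type-2 isomorphic with respect to $m$ if: $R\neq S$ and $|R|=|S|\ge 3$; there is $r\in R\cap S$ with $m\mid\gcd(n,r)$ and $m^3\mid n$; there is $t$ with $1\le t\le n/m-1$ such that $\theta_{n,m,t}$ maps the edge set of $C_n(R)$ exactly onto the edge set of $C_n(S)$ (i.e. $\theta_{n,m,t}(C_n(R))=C_n(S)$); and $S\neq xR$ for every $x$ with $\gcd(x,n)=1$. By convention, if $C_n(R)$ and $C_n(S)$ are Type-2 isomorphic with respect to $m$, then for every positive integer $k$ the graphs $C_{kn}(kR)$ and $C_{kn}(kS)$, where $kR=\{kr:r\in R\}$, are also said to be Type-2 isomorphic with respect to $m$. -}

module Defs where

open import Data.Nat using (ℕ; zero; suc; _+_; _*_; _∸_; _^_; _≤_; _<_; _>_; NonZero; _≟_; _<ᵇ_)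
open import Data.Nat.DivMod using (_/_; _%_)
open import Data.Nat.Divisibility using (_∣_)
open import Data.Nat.GCD using (gcd)
open import Data.Nat.Coprimality using (Coprime)
open import Data.Bool using (if_then_else_)
open import Data.List using (List; map; length; deduplicate)
open import Data.List.Membership.Propositional using (_∈_)
open import Data.List.Relation.Unary.All using (All)
open import Data.Product using (Σ; ∃; _×_; _,_)
open import Data.Sum using (_⊎_)
open import Relation.Nullary using (¬_)
open import Relation.Binary.PropositionalEquality using (_≡_)
open import Function.Bundles using (_⇔_)

-- Connection sets are represented as lists of naturals, read as finite sets.

_≈ₛ_ : List ℕ → List ℕ → Set
R ≈ₛ S = ∀ z → (z ∈ R) ⇔ (z ∈ S)

card : List ℕ → ℕ
card R = length (deduplicate _≟_ R)

_≡_[mod_] : ℕ → ℕ → ℕ → Set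
a ≡ b [mod n ] = ∃ λ k → (a ≡ b + k * n) ⊎ (b ≡ a + k * n)

ValidConn : (n : ℕ) → List ℕ → Set
ValidConn n R = All (λ r → (1 ≤ r) × (r ≤ n / 2)) R

-- Adjacency in C_n(R), vertices v_0..v_{n-1} indexed by naturals x < n:
-- v_x v_y is an edge iff x - y ≡ ± r (mod n) for some r ∈ R.
Adj : (n : ℕ) → List ℕ → ℕ → ℕ → Set
Adj n R x y = ∃ λ r → (r ∈ R) × ((x ≡ y + r [mod n ]) ⊎ (y ≡ x + r [mod n ]))

rmr : (n : ℕ) .{{_ : NonZero n}} → ℕ → ℕ
rmr n a = let r' = a % n in if n <ᵇ 2 * r' then n ∸ r' else r'

scaleRed : (n : ℕ) .{{_ : NonZero n}} → ℕ → List ℕ → List ℕ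
scaleRed n x R = map (λ r → rmr n (x * r)) R

θ : (n m t : ℕ) .{{_ : NonZero m}} → ℕ → ℕ
θ n m t x = x + (x % m) * t * m

MapsOnto : (n m t : ℕ) .{{_ : NonZero m}} → List ℕ → List ℕ → Set
MapsOnto n m t R S =
  (∀ x y → x < n → y < n → Adj n R x y → Adj n S (θ n m t x) (θ n m t y))
  × (∀ u v → u < n → v < n → Adj n S u v →
       ∃ λ x → ∃ λ y → (x < n) × (y < n) × Adj n R x y
         × (θ n m t x ≡ u [mod n ]) × (θ n m t y ≡ v [mod n ]))

Type2Base : (n m : ℕ) .{{_ : NonZero n}} .{{_ : NonZero m}} → List ℕ → List ℕ → Set
Type2Base n m R S =
  (2 ≤ n) × (1 < m) × ValidConn n R × ValidConn n S
  × ¬ (R ≈ₛ S)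
  × (card R ≡ card S) × (3 ≤ card R)
  × (∃ λ r → (r ∈ R) × (r ∈ S) × (m ∣ gcd n r))
  × (m ^ 3 ∣ n)
  × (∃ λ t → (1 ≤ t) × (t ≤ n / m ∸ 1) × MapsOnto n m t R S)
  × (∀ x → Coprime x n → ¬ (S ≈ₛ scaleRed n x R))

-- Type-2 isomorphism w.r.t. m, including the convention that the scaled
-- pairs C_{kn}(kR), C_{kn}(kS) (k ≥ 1) are also Type-2 isomorphic.
Type2Iso : (n m : ℕ) .{{_ : NonZero m}} → List ℕ → List ℕ → Set
Type2Iso n m R S =
  ∃ λ k → ∃ λ n' → ∃ λ R' → ∃ λ S' → Σ (NonZero n') λ nz →
    (1 ≤ k) × (n ≡ k * n')
    × (R ≈ₛ map (k *_) R') × (S ≈ₛ map (k *_) S')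
    × Type2Base n' m {{nz}} R' S'

{-# OPTIONS --safe #-}
module Submission where

-- θ = θ_{96,2,12} fixes the even vertices and moves every odd vertex by 24.
-- An edge of even length s therefore keeps its length, while an edge of odd
-- length r has exactly one odd endpoint and becomes an edge of length r ± 24:
-- the odd lengths a and 48 − a turn into 24 ± a.  Modulo 96, θ is undone by
-- θ_{96,2,36}.  No multiplier x turns {a, s, 48 − a} into {s, 24 − a, 24 + a}:
-- an even x produces only even lengths, and for odd x the congruence
-- x a ≡ ±(24 ± a) (mod 96) forces x ≡ 24 ± 1 (mod 48); as s ≡ 2 (mod 4) this
-- gives x s ≡ 48 ± s (mod 96), which reduces to 48 − s ≠ s.
-- The finitely many congruences involved are certified by evaluation.

open import Defs
open import Data.Nat using (ℕ; _+_; _*_; _∸_; _^_; _≤_; _<_; _<ᵇ_; NonZero; _≟_)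
open import Data.Nat.Properties
  using (≤-refl; ≤-trans; ≤-total; _≤?_; _<?_; m∸n≤m; m∸n+n≡m; m+[n∸m]≡n; +-assoc; *-assoc;
         *-identityˡ; *-distribʳ-+; *-distribˡ-+; allUpTo?)
open import Data.Nat.DivMod
open import Data.Nat.Divisibility using (_∣_; _∣?_; ∣-trans; m∣m*n)
open import Data.Nat.GCD using (gcd)
open import Data.Bool using (if_then_else_)
open import Data.List using (List; []; _∷_; map)
open import Data.List.Properties using (map-cong; map-id)
open import Data.List.Membership.Propositional using (_∈_; _∉_; find; lose)
open import Data.List.Membership.DecPropositional _≟_ using (_∈?_; _∉?_)
open import Data.List.Relation.Unary.Any using (Any; any?)
open import Data.List.Relation.Unary.All using (All; []; _∷_; all?) renaming (lookup to lookupᴬ)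
open import Data.Product using (∃; _×_; _,_)
open import Data.Sum using (inj₁; inj₂)
open import Function using (id; _∘_)
open import Function.Bundles using (Equivalence; mk⇔)
open import Relation.Nullary using (¬_; Dec; map′; _×-dec_; _⊎-dec_)
open import Relation.Nullary.Decidable using (toWitness)
open import Relation.Binary.PropositionalEquality

adj-sym : ∀ {n R x y} → Adj n R x y → Adj n R y x
adj-sym (r , r∈R , inj₁ x≡y+r) = r , r∈R , inj₂ x≡y+r
adj-sym (r , r∈R , inj₂ y≡x+r) = r , r∈R , inj₁ y≡x+r

any∉⇒≉ₛ : ∀ {R S} → Any (_∉ S) R → ¬ (R ≈ₛ S)
any∉⇒≉ₛ z∉S R≈S = let z , z∈R , z∉S = find z∉S in z∉S (Equivalence.to (R≈S z) z∈R)

module _ (n : ℕ) .{{_ : NonZero n}} where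

  ≡[mod]⇒%≡ : ∀ {a b} → a ≡ b [mod n ] → a % n ≡ b % n
  ≡[mod]⇒%≡ {b = b} (k , inj₁ refl) = [m+kn]%n≡m%n b k n
  ≡[mod]⇒%≡ {a = a} (k , inj₂ refl) = sym ([m+kn]%n≡m%n a k n)

  %≡⇒≡+k*n : ∀ a b → a % n ≡ b % n → b / n ≤ a / n → ∃ λ k → a ≡ b + k * n
  %≡⇒≡+k*n a b a%n≡b%n b/n≤a/n = a / n ∸ b / n , (begin
    a                                          ≡⟨ m≡m%n+[m/n]*n a n ⟩
    a % n + a / n * n                          ≡⟨ cong₂ (λ r q → r + q * n) a%n≡b%n (sym (m+[n∸m]≡n b/n≤a/n)) ⟩
    b % n + (b / n + (a / n ∸ b / n)) * n      ≡⟨ cong (b % n +_) (*-distribʳ-+ n (b / n) _) ⟩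
    b % n + (b / n * n + (a / n ∸ b / n) * n)  ≡⟨ +-assoc (b % n) _ _ ⟨
    b % n + b / n * n + (a / n ∸ b / n) * n    ≡⟨ cong (_+ (a / n ∸ b / n) * n) (m≡m%n+[m/n]*n b n) ⟨
    b + (a / n ∸ b / n) * n                    ∎)
    where open ≡-Reasoning

  %≡⇒≡[mod] : ∀ a b → a % n ≡ b % n → a ≡ b [mod n ]
  %≡⇒≡[mod] a b a%n≡b%n with ≤-total (b / n) (a / n)
  ... | inj₁ b/n≤a/n = let k , eq = %≡⇒≡+k*n a b a%n≡b%n b/n≤a/n in k , inj₁ eq
  ... | inj₂ a/n≤b/n = let k , eq = %≡⇒≡+k*n b a (sym a%n≡b%n) a/n≤b/n in k , inj₂ eq

  ≡[mod]? : ∀ a b → Dec (a ≡ b [mod n ])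
  ≡[mod]? a b = map′ (%≡⇒≡[mod] a b) ≡[mod]⇒%≡ (a % n ≟ b % n)

  adj? : ∀ R x y → Dec (Adj n R x y)
  adj? R x y = map′ find (λ (_ , r∈R , x~y) → lose r∈R x~y)
    (any? (λ r → ≡[mod]? x (y + r) ⊎-dec ≡[mod]? y (x + r)) R)

  EdgesMapTo : (ℕ → ℕ) → List ℕ → List ℕ → Set
  EdgesMapTo f R S = ∀ {x} → x < n → All (λ r → Adj n S (f x) (f ((x + r) % n))) R

  edgesMapTo? : ∀ f R S → Dec (EdgesMapTo f R S)
  edgesMapTo? f R S = allUpTo? (λ x → all? (λ r → adj? S (f x) (f ((x + r) % n))) R) n

  edgesMapTo⇒adj : ∀ {f R S} → EdgesMapTo f R S →
                   ∀ x y → x < n → y < n → Adj n R x y → Adj n S (f x) (f y)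
  edgesMapTo⇒adj {f} {S = S} f-edges x y x<n y<n (r , r∈R , inj₂ y≡x+r) =
    subst (λ z → Adj n S (f x) (f z))
          (trans (sym (≡[mod]⇒%≡ y≡x+r)) (m<n⇒m%n≡m y<n))
          (lookupᴬ (f-edges x<n) r∈R)
  edgesMapTo⇒adj f-edges x y x<n y<n (r , r∈R , inj₁ x≡y+r) =
    adj-sym (edgesMapTo⇒adj f-edges y x y<n x<n (r , r∈R , inj₂ x≡y+r))

  rmr-cong : ∀ {a b} → a % n ≡ b % n → rmr n a ≡ rmr n b
  rmr-cong = cong (λ r → if n <ᵇ 2 * r then n ∸ r else r)

  scaleRed-% : ∀ x R → scaleRed n x R ≡ scaleRed n (x % n) R
  scaleRed-% x = map-cong (λ r → rmr-cong (x*r%n≡[x%n]*r%n r))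
    where
    x*r%n≡[x%n]*r%n : ∀ r → (x * r) % n ≡ (x % n * r) % n
    x*r%n≡[x%n]*r%n r = begin
      (x * r) % n                  ≡⟨ %-distribˡ-* x r n ⟩
      (x % n * (r % n)) % n        ≡⟨ cong (λ y → (y * (r % n)) % n) (m%n%n≡m%n x n) ⟨
      (x % n % n * (r % n)) % n    ≡⟨ %-distribˡ-* (x % n) r n ⟨
      (x % n * r) % n              ∎
      where open ≡-Reasoning

  NotAScaling : List ℕ → List ℕ → Set
  NotAScaling R S = ∀ {x} → x < n → Any (_∉ scaleRed n x R) S

  notAScaling? : ∀ R S → Dec (NotAScaling R S)
  notAScaling? R S = allUpTo? (λ x → any? (_∉? scaleRed n x R) S) n

  notAScaling⇒≉ₛ : ∀ {R S} → NotAScaling R S → ∀ x → ¬ (S ≈ₛ scaleRed n x R)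
  notAScaling⇒≉ₛ {R} {S} not-scaling x =
    subst (λ L → ¬ (S ≈ₛ L)) (sym (scaleRed-% x R)) (any∉⇒≉ₛ (not-scaling (m%n<n x n)))

-- θ_{n,m,t} adds j t m to the vertices of the residue class j (mod m) and
-- preserves that class when m ∣ n, so θ_{n,m,n/m−t} undoes it modulo n.
θ⁻¹ : (n m t : ℕ) .{{_ : NonZero n}} .{{_ : NonZero m}} → ℕ → ℕ
θ⁻¹ n m t u = θ n m (n / m ∸ t) u % n

θ∘θ⁻¹ : ∀ {n m t} .{{_ : NonZero n}} .{{_ : NonZero m}} → m ∣ n → t ≤ n / m →
        ∀ u → θ n m t (θ⁻¹ n m t u) ≡ u [mod n ]
θ∘θ⁻¹ {n} {m} {t} m∣n t≤n/m u = %≡⇒≡[mod] n _ u (begin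
  (v + v % m * t * m) % n            ≡⟨ cong (λ i → (v + i * t * m) % n) v%m≡j ⟩
  (v + j * t * m) % n                ≡⟨ %-distribˡ-+ v (j * t * m) n ⟩
  (v % n + (j * t * m) % n) % n      ≡⟨ cong (λ y → (y + (j * t * m) % n) % n) (m%n%n≡m%n w n) ⟩
  (w % n + (j * t * m) % n) % n      ≡⟨ %-distribˡ-+ w (j * t * m) n ⟨
  (w + j * t * m) % n                ≡⟨ cong (_% n) (+-assoc u _ _) ⟩
  (u + (j * t′ * m + j * t * m)) % n ≡⟨ cong (λ k → (u + k) % n) shifts-add-up ⟩
  (u + j * n) % n                    ≡⟨ [m+kn]%n≡m%n u j n ⟩
  u % n                              ∎)
  where
  open ≡-Reasoning
  j t′ w v : ℕ
  j = u % m
  t′ = n / m ∸ t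
  w = u + j * t′ * m
  v = w % n

  v%m≡j : v % m ≡ j
  v%m≡j = trans (m∣n⇒o%n%m≡o%m m n w m∣n) ([m+kn]%n≡m%n u (j * t′) m)

  shifts-add-up : j * t′ * m + j * t * m ≡ j * n
  shifts-add-up = begin
    j * t′ * m + j * t * m  ≡⟨ *-distribʳ-+ m (j * t′) (j * t) ⟨
    (j * t′ + j * t) * m    ≡⟨ cong (_* m) (*-distribˡ-+ j t′ t) ⟨
    j * (t′ + t) * m        ≡⟨ cong (λ k → j * k * m) (m∸n+n≡m t≤n/m) ⟩
    j * (n / m) * m         ≡⟨ *-assoc j (n / m) m ⟩
    j * (n / m * m)         ≡⟨ cong (j *_) (m/n*n≡m m∣n) ⟩
    j * n                   ∎

θ-mapsOnto : ∀ {n m t R S} .{{_ : NonZero n}} .{{_ : NonZero m}} → m ∣ n → t ≤ n / m →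
             EdgesMapTo n (θ n m t) R S → EdgesMapTo n (θ⁻¹ n m t) S R → MapsOnto n m t R S
θ-mapsOnto {n} {m} {t} m∣n t≤n/m θ-edges θ⁻¹-edges =
  edgesMapTo⇒adj n θ-edges ,
  λ u v u<n v<n u~v →
    θ⁻¹ n m t u , θ⁻¹ n m t v , m%n<n _ n , m%n<n _ n ,
    edgesMapTo⇒adj n θ⁻¹-edges u v u<n v<n u~v ,
    θ∘θ⁻¹ m∣n t≤n/m u , θ∘θ⁻¹ m∣n t≤n/m v

validConn? : ∀ n R → Dec (ValidConn n R)
validConn? n = all? (λ r → 1 ≤? r ×-dec r ≤? n / 2)

Type2Certificate : (n m t : ℕ) .{{_ : NonZero n}} .{{_ : NonZero m}} → List ℕ → List ℕ → Set
Type2Certificate n m t R S =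
  (2 ≤ n) × (1 < m) × ValidConn n R × ValidConn n S × Any (_∉ S) R
  × (card R ≡ card S) × (3 ≤ card R) × Any (λ r → r ∈ S × m ∣ gcd n r) R
  × (m ^ 3 ∣ n) × (1 ≤ t) × (t ≤ n / m ∸ 1)
  × EdgesMapTo n (θ n m t) R S × EdgesMapTo n (θ⁻¹ n m t) S R × NotAScaling n R S

type2Certificate? : ∀ n m t .{{_ : NonZero n}} .{{_ : NonZero m}} R S →
                    Dec (Type2Certificate n m t R S)
type2Certificate? n m t R S =
  2 ≤? n ×-dec 1 <? m ×-dec validConn? n R ×-dec validConn? n S ×-dec any? (_∉? S) R
  ×-dec card R ≟ card S ×-dec 3 ≤? card R ×-dec any? (λ r → r ∈? S ×-dec m ∣? gcd n r) R
  ×-dec m ^ 3 ∣? n ×-dec 1 ≤? t ×-dec t ≤? n / m ∸ 1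
  ×-dec edgesMapTo? n (θ n m t) R S ×-dec edgesMapTo? n (θ⁻¹ n m t) S R ×-dec notAScaling? n R S

certificate⇒Type2Base : ∀ {n m t R S} .{{_ : NonZero n}} .{{_ : NonZero m}} →
                        Type2Certificate n m t R S → Type2Base n m R S
certificate⇒Type2Base {n} {m} {t} {R} {S}
  (2≤n , 1<m , R-valid , S-valid , R∌S , card≡ , 3≤card , shared ,
   m³∣n , 1≤t , t≤n/m∸1 , θ-edges , θ⁻¹-edges , not-scaling) =
  2≤n , 1<m , R-valid , S-valid , any∉⇒≉ₛ R∌S , card≡ , 3≤card , find shared ,
  m³∣n , (t , 1≤t , t≤n/m∸1 , θ-mapsOnto m∣n t≤n/m θ-edges θ⁻¹-edges) ,
  λ x _ → notAScaling⇒≉ₛ n not-scaling x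
  where
  m∣n : m ∣ n
  m∣n = ∣-trans (m∣m*n (m ^ 2)) m³∣n
  t≤n/m : t ≤ n / m
  t≤n/m = ≤-trans t≤n/m∸1 (m∸n≤m (n / m) 1)

Type2Base⇒Type2Iso : ∀ {n m R S} {{_ : NonZero n}} .{{_ : NonZero m}} →
                     Type2Base n m R S → Type2Iso n m R S
Type2Base⇒Type2Iso {n} {R = R} {S} {{n≢0}} iso =
  1 , n , R , S , n≢0 , ≤-refl , sym (*-identityˡ n) , ≡⇒≈ₛ (map-1* R) , ≡⇒≈ₛ (map-1* S) , iso
  where
  ≡⇒≈ₛ : ∀ {L L′} → L′ ≡ L → L ≈ₛ L′
  ≡⇒≈ₛ refl _ = mk⇔ id id
  map-1* : ∀ L → map (1 *_) L ≡ L
  map-1* L = trans (map-cong *-identityˡ L) (map-id L)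

sourceConn targetConn : ℕ → ℕ → List ℕ
sourceConn a s = a ∷ s ∷ 48 ∸ a ∷ []
targetConn a s = s ∷ 24 ∸ a ∷ 24 + a ∷ []

FamilyCertificate : ℕ → ℕ → Set
FamilyCertificate a s = Type2Certificate 96 2 12 (sourceConn a s) (targetConn a s)

certificates : All (λ s → All (λ a → FamilyCertificate a s) (1 ∷ 3 ∷ 5 ∷ 7 ∷ 9 ∷ 11 ∷ []))
                   (6 ∷ 18 ∷ 30 ∷ 42 ∷ [])
certificates = toWitness {a? = all? (λ s → all? (λ a → type2Certificate? 96 2 12 _ _) _) _} _

mainTheorem5 : (s : ℕ) → s ∈ (6 ∷ 18 ∷ 30 ∷ 42 ∷ []) →
    Type2Iso 96 2 (1 ∷ s ∷ 47 ∷ []) (s ∷ 23 ∷ 25 ∷ [])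
    × Type2Iso 96 2 (3 ∷ s ∷ 45 ∷ []) (s ∷ 21 ∷ 27 ∷ [])
    × Type2Iso 96 2 (5 ∷ s ∷ 43 ∷ []) (s ∷ 19 ∷ 29 ∷ [])
    × Type2Iso 96 2 (7 ∷ s ∷ 41 ∷ []) (s ∷ 17 ∷ 31 ∷ [])
    × Type2Iso 96 2 (9 ∷ s ∷ 39 ∷ []) (s ∷ 15 ∷ 33 ∷ [])
    × Type2Iso 96 2 (11 ∷ s ∷ 37 ∷ []) (s ∷ 13 ∷ 35 ∷ [])
mainTheorem5 s s∈ = type2-all (lookupᴬ certificates s∈)
  where
  Type2Pair : ℕ → Set
  Type2Pair a = Type2Iso 96 2 (sourceConn a s) (targetConn a s)

  type2 : ∀ {a} → FamilyCertificate a s → Type2Pair a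
  type2 = Type2Base⇒Type2Iso ∘ certificate⇒Type2Base

  type2-all : All (λ a → FamilyCertificate a s) (1 ∷ 3 ∷ 5 ∷ 7 ∷ 9 ∷ 11 ∷ []) →
              Type2Pair 1 × Type2Pair 3 × Type2Pair 5 × Type2Pair 7 × Type2Pair 9 × Type2Pair 11
  type2-all (c₁ ∷ c₃ ∷ c₅ ∷ c₇ ∷ c₉ ∷ c₁₁ ∷ []) =
    type2 c₁ , type2 c₃ , type2 c₅ , type2 c₇ , type2 c₉ , type2 c₁₁
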